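{- Let $n$ be a positive integer and let $L_1,\ldots,L_N$ be a sequence of triples in $\{1,\ldots,n\}^3$ such that for every $i<j$ there are at least two coordinates in which $L_i$ is strictly less than $L_j$. Let $G$ be the bipartite graph on vertex set $\{a_1,\ldots,a_n,b_1,\ldots,b_n\}$ in which, for each triple $(x,y,z)$ of the sequence, $a_x$ and $b_y$ are joined by an edge labeled $z$. Then for each $z\in\{1,\ldots,n\}$, the set $E_z$ of edges labeled $z$ forms an induced matching of $G$: the subgraph of $G$ (including edges of all labels) induced by the set of vertices covered by edges of $E_z$ is a matching, consisting exactly of the edges of $E_z$. -}

module Defs where

open import Data.Nat using (ℕ)
open import Data.Fin using (Fin; _<_)
open import Data.Product using (_×_; _,_; ∃; Σ)
open import Data.Sum using (_⊎_)
open import Relation.Binary.PropositionalEquality using (_≡_)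

-- Triples in {1,…,n}^3, with {1,…,n} represented by Fin n (order-preserving shift by one).
Triple : ℕ → Set
Triple n = Fin n × Fin n × Fin n

LessInTwo : ∀ {n} → Triple n → Triple n → Set
LessInTwo (x , y , z) (x' , y' , z') =
  (x < x' × y < y') ⊎ ((x < x' × z < z') ⊎ (y < y' × z < z'))

Admissible : ∀ {n N} → (Fin N → Triple n) → Set
Admissible {N = N} L = ∀ (i j : Fin N) → i < j → LessInTwo (L i) (L j)

data Vertex (n : ℕ) : Set where
  a : Fin n → Vertex n
  b : Fin n → Vertex n

-- An edge of G is always between some a_x and some b_y; we write it as the pair (x , y).
LabeledEdge : ∀ {n N} → (Fin N → Triple n) → Fin n → Fin n → Fin n → Set
LabeledEdge {N = N} L x y z = Σ (Fin N) λ k → L k ≡ (x , y , z)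

Edge : ∀ {n N} → (Fin N → Triple n) → Fin n → Fin n → Set
Edge L x y = ∃ λ z → LabeledEdge L x y z

InE : ∀ {n N} → (Fin N → Triple n) → Fin n → Fin n → Fin n → Set
InE L z x y = LabeledEdge L x y z

Covered : ∀ {n N} → (Fin N → Triple n) → Fin n → Vertex n → Set
Covered L z (a x) = ∃ λ y → InE L z x y
Covered L z (b y) = ∃ λ x → InE L z x y

-- E_z is an induced matching of G:
--  (1) E_z is a matching: two edges of E_z sharing a vertex are the same edge;
--  (2) every edge of G with both endpoints covered by E_z belongs to E_z
--      (so the induced subgraph on the covered vertices has edge set exactly E_z).
IsInducedMatching : ∀ {n N} → (Fin N → Triple n) → Fin n → Set
IsInducedMatching L z =
  (∀ x y x' y' → InE L z x y → InE L z x' y' →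
     (a x ≡ a x' ⊎ b y ≡ b y') → (x ≡ x' × y ≡ y'))
  × (∀ x y → Edge L x y → Covered L z (a x) → Covered L z (b y) → InE L z x y)

-- Two triples of the sequence that agree in one coordinate are strictly ordered
-- in the other two, the earlier one being smaller. Two edges of E_z sharing an
-- endpoint come from triples agreeing in two coordinates, so they are the same
-- triple. For the induced part, an edge a_x b_y labelled w and the edges of E_z
-- at a_x and at b_y come from three triples pairwise agreeing in a coordinate;
-- if they were distinct, each of the 3! orders of their positions in the
-- sequence would make some coordinate both increase and decrease.
module Submission where

open import Defs
open import Data.Nat using (ℕ; _≥_)
open import Data.Fin using (Fin; _<_)
open import Data.Fin.Properties using (<-cmp; <-asym; <-irrefl)
open import Data.Product using (_×_; _,_; proj₁; proj₂)
open import Data.Sum using (_⊎_; inj₁; inj₂)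
open import Data.Empty using (⊥-elim)
open import Relation.Nullary using (¬_)
open import Relation.Binary using (tri<; tri≈; tri>)
open import Relation.Binary.PropositionalEquality using (_≡_; refl; sym; trans; subst₂)

private
  variable
    n N : ℕ
    x y z x′ y′ z′ : Fin n
    k k′ : Fin N

lessInTwo-sameˣ : LessInTwo (x , y , z) (x , y′ , z′) → y < y′ × z < z′
lessInTwo-sameˣ (inj₁ (x<x , _))         = ⊥-elim (<-irrefl refl x<x)
lessInTwo-sameˣ (inj₂ (inj₁ (x<x , _)))  = ⊥-elim (<-irrefl refl x<x)
lessInTwo-sameˣ (inj₂ (inj₂ y<y′×z<z′)) = y<y′×z<z′

lessInTwo-sameʸ : LessInTwo (x , y , z) (x′ , y , z′) → x < x′ × z < z′
lessInTwo-sameʸ (inj₁ (_ , y<y))         = ⊥-elim (<-irrefl refl y<y)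
lessInTwo-sameʸ (inj₂ (inj₁ x<x′×z<z′)) = x<x′×z<z′
lessInTwo-sameʸ (inj₂ (inj₂ (y<y , _)))  = ⊥-elim (<-irrefl refl y<y)

lessInTwo-sameᶻ : LessInTwo (x , y , z) (x′ , y′ , z) → x < x′ × y < y′
lessInTwo-sameᶻ (inj₁ x<x′×y<y′)        = x<x′×y<y′
lessInTwo-sameᶻ (inj₂ (inj₁ (_ , z<z)))  = ⊥-elim (<-irrefl refl z<z)
lessInTwo-sameᶻ (inj₂ (inj₂ (_ , z<z)))  = ⊥-elim (<-irrefl refl z<z)

¬lessInTwo-sameˣᶻ : ¬ LessInTwo (x , y , z) (x , y′ , z)
¬lessInTwo-sameˣᶻ p = <-irrefl refl (proj₂ (lessInTwo-sameˣ p))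

¬lessInTwo-sameʸᶻ : ¬ LessInTwo (x , y , z) (x′ , y , z)
¬lessInTwo-sameʸᶻ p = <-irrefl refl (proj₂ (lessInTwo-sameʸ p))

≡-coordinatewise : ∀ {t : Triple n} {x₁ x₂ y₁ y₂ z₁ z₂} →
  t ≡ (x , y₁ , z₁) → t ≡ (x₁ , y , z₂) → t ≡ (x₂ , y₂ , z) → t ≡ (x , y , z)
≡-coordinatewise refl refl refl = refl

module _ {L : Fin N → Triple n} (adm : Admissible L) where

  ordered : ∀ {s t} → L k ≡ s → L k′ ≡ t → k < k′ → LessInTwo s t
  ordered {k = k} {k′ = k′} e e′ k<k′ = subst₂ LessInTwo e e′ (adm k k′ k<k′)

  ordered-sameˣ : L k ≡ (x , y , z) → L k′ ≡ (x , y′ , z′) → k < k′ → y < y′ × z < z′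
  ordered-sameˣ e e′ k<k′ = lessInTwo-sameˣ (ordered e e′ k<k′)

  ordered-sameʸ : L k ≡ (x , y , z) → L k′ ≡ (x′ , y , z′) → k < k′ → x < x′ × z < z′
  ordered-sameʸ e e′ k<k′ = lessInTwo-sameʸ (ordered e e′ k<k′)

  ordered-sameᶻ : L k ≡ (x , y , z) → L k′ ≡ (x′ , y′ , z) → k < k′ → x < x′ × y < y′
  ordered-sameᶻ e e′ k<k′ = lessInTwo-sameᶻ (ordered e e′ k<k′)

  index-unique : ∀ {s t} → L k ≡ s → L k′ ≡ t →
    ¬ LessInTwo s t → ¬ LessInTwo t s → k ≡ k′
  index-unique {k = k} {k′ = k′} e e′ s≮t t≮s with <-cmp k k′
  ... | tri< k<k′ _ _ = ⊥-elim (s≮t (ordered e e′ k<k′))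
  ... | tri≈ _ k≡k′ _ = k≡k′
  ... | tri> _ _ k′<k = ⊥-elim (t≮s (ordered e′ e k′<k))

  matching : ∀ z x y x′ y′ → InE L z x y → InE L z x′ y′ →
    (a x ≡ a x′ ⊎ b y ≡ b y′) → x ≡ x′ × y ≡ y′
  matching z x y .x y′ (k , e) (k′ , e′) (inj₁ refl)
    with refl ← index-unique e e′ ¬lessInTwo-sameˣᶻ ¬lessInTwo-sameˣᶻ
    with refl ← trans (sym e) e′ = refl , refl
  matching z x y x′ .y (k , e) (k′ , e′) (inj₂ refl)
    with refl ← index-unique e e′ ¬lessInTwo-sameʸᶻ ¬lessInTwo-sameʸᶻ
    with refl ← trans (sym e) e′ = refl , refl

  induced : ∀ z x y → Edge L x y → Covered L z (a x) → Covered L z (b y) → InE L z x y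
  induced z x y (w , k , e) (y₁ , k₁ , e₁) (x₂ , k₂ , e₂)
    with <-cmp k k₁ | <-cmp k k₂ | <-cmp k₁ k₂
  ... | tri≈ _ refl _ | _ | _ = k  , ≡-coordinatewise e e e₁
  ... | _ | tri≈ _ refl _ | _ = k  , ≡-coordinatewise e e e₂
  ... | _ | _ | tri≈ _ refl _ = k₁ , ≡-coordinatewise e₁ e₂ e₁
  ... | tri< p _ _ | tri< _ _ _ | tri< r _ _ =
    ⊥-elim (<-asym (proj₁ (ordered-sameˣ e e₁ p)) (proj₂ (ordered-sameᶻ e₁ e₂ r)))
  ... | tri< _ _ _ | tri< q _ _ | tri> _ _ r =
    ⊥-elim (<-asym (proj₁ (ordered-sameʸ e e₂ q)) (proj₁ (ordered-sameᶻ e₂ e₁ r)))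
  ... | tri< p _ _ | tri> _ _ q | _ =
    ⊥-elim (<-asym (proj₂ (ordered-sameˣ e e₁ p)) (proj₂ (ordered-sameʸ e₂ e q)))
  ... | tri> _ _ p | tri< q _ _ | _ =
    ⊥-elim (<-asym (proj₂ (ordered-sameˣ e₁ e p)) (proj₂ (ordered-sameʸ e e₂ q)))
  ... | tri> _ _ _ | tri> _ _ q | tri< r _ _ =
    ⊥-elim (<-asym (proj₁ (ordered-sameʸ e₂ e q)) (proj₁ (ordered-sameᶻ e₁ e₂ r)))
  ... | tri> _ _ p | tri> _ _ _ | tri> _ _ r =
    ⊥-elim (<-asym (proj₁ (ordered-sameˣ e₁ e p)) (proj₂ (ordered-sameᶻ e₂ e₁ r)))

lemma2 : (n N : ℕ) → n ≥ 1 → (L : Fin N → Triple n) → Admissible L →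
    (z : Fin n) → IsInducedMatching L z
lemma2 n N _ L adm z = matching adm z , induced adm z
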